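{- Let $m,n,h,r,s,\lambda$ be positive integers with $n>m>h\ge2$. If an $r$-factorization of $\mathcal G:=\lambda K_m^h$ can be embedded into a connected $s$-factorization of $\lambda K_n^h$, then (M1) $(m,r,\lambda)$ and $(n,s,\lambda)$ are $h$-admissible; (M2) $1<s/r\le\binom{n-1}{h-1}/\binom{m-1}{h-1}$; (M3) $n\ge\frac{h}{h-1}m$ if $s/r<\binom{n-1}{h-1}/\binom{m-1}{h-1}$; (M4) $n\ge\frac{h-r/s}{h-1}m$ if $s/r=\binom{n-1}{h-1}/\binom{m-1}{h-1}$.
   Context: $\lambda K_n^h$: $n$ vertices, every $h$-subset an edge of multiplicity $\lambda$; $\lambda K_m^h$ is its sub-hypergraph induced on a fixed set of $m$ vertices. An $r$-factor is a spanning sub-hypergraph in which every vertex has degree $r$; an $r$-factorization is a partition of the edge multiset into $r$-factors. An $r$-factorization of $\lambda K_m^h$ embeds into (extends to) a connected $s$-factorization of $\lambda K_n^h$ if there is a partition of the edges of $\lambda K_n^h$ into $s$-factors, each connected, such that each of the given $r$-factors is contained in one of these $s$-factors and distinct $r$-factors are contained in distinct $s$-factors. $(n,r,\lambda)$ is $h$-admissible if $h\mid rn$ and $r\mid\lambda\binom{n-1}{h-1}$. -}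

module Defs where

open import Data.Nat using (ℕ; zero; suc; _+_; _*_; _∸_; _≤_; _<_; z≤n; s≤s)
open import Data.Nat.Divisibility using (_∣_)
open import Data.Nat.Combinatorics using (_C_)
open import Data.Bool using (Bool; true; false)
open import Data.Fin using (Fin) renaming (_≟_ to _≟ᶠ_)
open import Data.Fin.Subset using (Subset; ∣_∣; _∈_)
open import Data.Fin.Subset.Properties using (_∈?_)
open import Data.List using (List; []; _∷_; [_]; map; _++_; filter; length; cartesianProduct; allFin)
open import Data.Vec using (Vec; replicate) renaming ([] to []ᵛ; _∷_ to _∷ᵛ_)
open import Data.Product using (Σ; _×_; _,_; proj₁; proj₂)
open import Function using (Injective)
open import Relation.Binary.PropositionalEquality using (_≡_)
open import Relation.Nullary.Decidable using (_×-dec_)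
import Data.Nat as ℕ

subsets : (n : ℕ) → List (Subset n)
subsets zero = [ []ᵛ ]
subsets (suc n) = map (true ∷ᵛ_) (subsets n) ++ map (false ∷ᵛ_) (subsets n)

hSubsets : (n h : ℕ) → List (Subset n)
hSubsets n h = filter (λ e → ∣ e ∣ ℕ.≟ h) (subsets n)

-- The edge multiset of lam K_n^h: every h-subset e, with copies (e , i), i : Fin lam.
edges : (n h lam : ℕ) → List (Subset n × Fin lam)
edges n h lam = cartesianProduct (hSubsets n h) (allFin lam)

-- A partition of the edges of lam K_n^h into k classes, given as a colouring of the
-- edge copies (values on non-h-subsets are irrelevant).
Colouring : (n lam k : ℕ) → Set
Colouring n lam k = Subset n → Fin lam → Fin k

deg : {n k : ℕ} (h lam : ℕ) → Colouring n lam k → Fin k → Fin n → ℕ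
deg {n} h lam c j v =
  length (filter (λ ei → (v ∈? proj₁ ei) ×-dec (c (proj₁ ei) (proj₂ ei) ≟ᶠ j)) (edges n h lam))

IsFactorization : (n h lam r k : ℕ) → Colouring n lam k → Set
IsFactorization n h lam r k c = (j : Fin k) (v : Fin n) → deg h lam c j v ≡ r

data Linked {n lam k : ℕ} (h : ℕ) (c : Colouring n lam k) (j : Fin k) : Fin n → Fin n → Set where
  here : ∀ {u} → Linked h c j u u
  step : ∀ {u w v} (e : Subset n) (i : Fin lam) → ∣ e ∣ ≡ h → c e i ≡ j →
         u ∈ e → w ∈ e → Linked h c j w v → Linked h c j u v

AllConnected : (n h lam k : ℕ) → Colouring n lam k → Set
AllConnected n h lam k c = (j : Fin k) (u v : Fin n) → Linked h c j u v

liftS : {m n : ℕ} → m ≤ n → Subset m → Subset n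
liftS {zero} {n} _ []ᵛ = replicate n false
liftS (s≤s p) (b ∷ᵛ e) = b ∷ᵛ liftS p e

Embeds : (m n h lam r s : ℕ) → m ≤ n → Set
Embeds m n h lam r s m≤n =
  Σ ℕ λ k′ → Σ (Colouring m lam k′) λ d → IsFactorization m h lam r k′ d ×
  Σ ℕ λ k → Σ (Colouring n lam k) λ c → IsFactorization n h lam s k c × AllConnected n h lam k c ×
  Σ (Fin k′ → Fin k) λ φ → Injective _≡_ _≡_ φ ×
    ((e : Subset m) (i : Fin lam) → ∣ e ∣ ≡ h → c (liftS m≤n e) i ≡ φ (d e i))

Admissible : (h n r lam : ℕ) → Set
Admissible h n r lam = (h ∣ r * n) × (r ∣ lam * ((n ∸ 1) C (h ∸ 1)))

-- Fix a class j of the big factorization and let N_j be the number of small classes mapped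
-- into it (N_j ≤ 1 by injectivity). The degree s of an inner vertex in class j is r·N_j plus
-- its number of crossing edges (edges meeting both the m inner and the n − m outer vertices).
-- A crossing edge has at most h − 1 inner vertices, so double counting against the handshake
-- lemma in class j gives h·m·s ≤ N_j·m·r + (h − 1)·n·s. When s/r is below the binomial ratio
-- the counts k′r = λ·C(m−1,h−1) and ks = λ·C(n−1,h−1) leave a class with N_j = 0, giving (M3);
-- a class with N_j = 1 gives (M4). If s ≤ r such a class has no crossing edges at all and so
-- is not connected, whence r < s.

module Submission where

open import Defs

open import Data.Bool using (true; false; if_then_else_)
open import Data.Nat using (ℕ; zero; suc; _+_; _*_; _∸_; _⊓_; _≤_; _<_; z≤n; s≤s; NonZero)
open import Data.Nat.Properties hiding (_≟_)
open import Data.Fin using (Fin; _≟_; inject≤; fromℕ<; toℕ) renaming (zero to fzero; suc to fsuc)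
open import Data.Empty using (⊥)
open import Data.Fin.Subset using (Subset; ∣_∣; _∈_)
open import Data.Fin.Subset.Properties using (_∈?_; ∣⊥∣≡0)
open import Data.List using ([]; _∷_; _++_; map; filter; length; cartesianProduct; allFin; tabulate)
open import Data.List.Properties using (map-++; map-∘; map-tabulate)
import Data.Nat.ListAction as List
open import Data.Nat.ListAction.Properties using (sum-++)
open import Data.Vec using ([]; _∷_; here; there; replicate)
open import Data.Fin.Properties using (toℕ-inject≤; toℕ-fromℕ<; toℕ<n; injective⇒≤)
  renaming (suc-injective to fsuc-injective; 0≢1+n to fzero≢fsuc)
open import Data.Product using (Σ; _,_; _×_)
open import Function using (Injective; _∘_; id)
open import Relation.Binary.PropositionalEquality
open import Relation.Unary using (Decidable)
open import Relation.Nullary using (Dec; yes; no; does; ¬_; contradiction)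
open import Relation.Nullary.Decidable using (_×-dec_)
open import Algebra.Properties.Semiring.Sum +-*-semiring
open import Algebra.Properties.CommutativeSemigroup *-commutativeSemigroup using (x∙yz≈y∙xz)
open import Algebra.Properties.CommutativeSemigroup +-commutativeSemigroup
  using () renaming (interchange to +-interchange; x∙yz≈y∙xz to +-left-comm)
import Data.Nat as ℕ
open import Data.Nat.Tactic.RingSolver using (solve-∀)
open import Data.Nat.Divisibility using (divides)
open import Data.Nat.Combinatorics using (_C_; nCk+nC[k+1]≡[n+1]C[k+1])

𝟙 : ∀ {p} {P : Set p} → Dec P → ℕ
𝟙 P? = if does P? then 1 else 0

𝟙-yes : ∀ {p} {P : Set p} (P? : Dec P) → P → 𝟙 P? ≡ 1
𝟙-yes (yes _) _ = refl
𝟙-yes (no ¬p) p = contradiction p ¬p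

𝟙-no : ∀ {p} {P : Set p} (P? : Dec P) → ¬ P → 𝟙 P? ≡ 0
𝟙-no (yes p) ¬p = contradiction p ¬p
𝟙-no (no _) _ = refl

𝟙-×-dec : ∀ {p q} {P : Set p} {Q : Set q} (P? : Dec P) (Q? : Dec Q) → 𝟙 (P? ×-dec Q?) ≡ 𝟙 P? * 𝟙 Q?
𝟙-×-dec P? Q? with does P? | does Q?
... | true  | true  = refl
... | true  | false = refl
... | false | _     = refl

module _ {p} {P : Set p} where

  𝟙*-cong : (P? : Dec P) {x y : ℕ} → (P → x ≡ y) → 𝟙 P? * x ≡ 𝟙 P? * y
  𝟙*-cong (yes p) x≡y = cong (1 *_) (x≡y p)
  𝟙*-cong (no _)  _   = refl

  *-𝟙*-cong : (P? : Dec P) {a b : ℕ} (x : ℕ) → (P → a ≡ b) → a * (𝟙 P? * x) ≡ b * (𝟙 P? * x)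
  *-𝟙*-cong (yes p) x a≡b = cong (_* (1 * x)) (a≡b p)
  *-𝟙*-cong (no _) {a} {b} x _ = trans (*-zeroʳ a) (sym (*-zeroʳ b))

  *-𝟙*-mono-≤ : (P? : Dec P) {a b : ℕ} (x : ℕ) → (P → a ≤ b) → a * (𝟙 P? * x) ≤ b * (𝟙 P? * x)
  *-𝟙*-mono-≤ (yes p) x a≤b = *-monoˡ-≤ (1 * x) (a≤b p)
  *-𝟙*-mono-≤ (no _) {a} {b} x _ = ≤-reflexive (trans (*-zeroʳ a) (sym (*-zeroʳ b)))

∑-zero : ∀ k {f : Fin k → ℕ} → (∀ i → f i ≡ 0) → ∑[ i < k ] f i ≡ 0
∑-zero k f≡0 = trans (sum-cong-≗ f≡0) (sum-replicate-zero k)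

∑-const : ∀ k a → ∑[ i < k ] a ≡ k * a
∑-const zero    a = refl
∑-const (suc k) a = cong (a +_) (∑-const k a)

≤-∑ : ∀ k (f : Fin k → ℕ) i → f i ≤ ∑[ j < k ] f j
≤-∑ (suc k) f fzero    = m≤m+n _ _
≤-∑ (suc k) f (fsuc i) = ≤-trans (≤-∑ k (f ∘ fsuc) i) (m≤n+m _ _)

∑<k⇒∃≡0 : ∀ k (f : Fin k → ℕ) → ∑[ i < k ] f i < k → Σ (Fin k) λ i → f i ≡ 0
∑<k⇒∃≡0 (suc k) f ∑<k with f fzero in eq
... | zero  = fzero , eq
... | suc x = let i , fi≡0 = ∑<k⇒∃≡0 k (f ∘ fsuc) (≤-pred (≤-trans (s≤s (s≤s (m≤n+m _ x))) ∑<k))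
              in fsuc i , fi≡0

∑-𝟙-≟ : ∀ k (a : Fin k) (g : Fin k → ℕ) → ∑[ j < k ] (𝟙 (a ≟ j) * g j) ≡ g a
∑-𝟙-≟ (suc k) fzero g =
  trans (cong (g fzero + 0 +_) (∑-zero k (λ _ → refl))) (trans (+-identityʳ _) (+-identityʳ _))
∑-𝟙-≟ (suc k) (fsuc a) g = ∑-𝟙-≟ k a (g ∘ fsuc)

∑-𝟙-≟≡1 : ∀ k (a : Fin k) → ∑[ j < k ] 𝟙 (a ≟ j) ≡ 1
∑-𝟙-≟≡1 k a = trans (sum-cong-≗ (λ j → sym (*-identityʳ (𝟙 (a ≟ j))))) (∑-𝟙-≟ k a (λ _ → 1))

module _ {k′ k : ℕ} (φ : Fin k′ → Fin k) where

  fibreSize : Fin k → ℕ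
  fibreSize j = ∑[ j′ < k′ ] 𝟙 (φ j′ ≟ j)

  ∑-fibreSize : ∑[ j < k ] fibreSize j ≡ k′
  ∑-fibreSize = begin
    ∑[ j < k ] ∑[ j′ < k′ ] 𝟙 (φ j′ ≟ j) ≡⟨ ∑-comm (λ j j′ → 𝟙 (φ j′ ≟ j)) ⟩
    ∑[ j′ < k′ ] ∑[ j < k ] 𝟙 (φ j′ ≟ j) ≡⟨ sum-cong-≗ (λ j′ → ∑-𝟙-≟≡1 k (φ j′)) ⟩
    ∑[ j′ < k′ ] 1                        ≡⟨ ∑-const k′ 1 ⟩
    k′ * 1                                ≡⟨ *-identityʳ k′ ⟩
    k′                                    ∎
    where open ≡-Reasoning

  k′<k⇒∃-emptyFibre : k′ < k → Σ (Fin k) λ j → fibreSize j ≡ 0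
  k′<k⇒∃-emptyFibre k′<k = ∑<k⇒∃≡0 k fibreSize (subst (_< k) (sym ∑-fibreSize) k′<k)

fibreSize-injective : ∀ {k′ k} (φ : Fin k′ → Fin k) → Injective _≡_ _≡_ φ → ∀ j → fibreSize φ j ≤ 1
fibreSize-injective {zero}   φ φ-inj j = z≤n
fibreSize-injective {suc k′} φ φ-inj j with φ fzero ≟ j
... | yes φ0≡j = s≤s (≤-reflexive (∑-zero k′ λ j′ →
                   𝟙-no (φ (fsuc j′) ≟ j) λ φj′≡j → fzero≢fsuc (φ-inj (trans φ0≡j (sym φj′≡j)))))
... | no _ = fibreSize-injective (φ ∘ fsuc) (fsuc-injective ∘ φ-inj) j

fibreSize-image : ∀ {k′ k} (φ : Fin k′ → Fin k) → Injective _≡_ _≡_ φ → ∀ a → fibreSize φ (φ a) ≡ 1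
fibreSize-image {k′} φ φ-inj a = ≤-antisym (fibreSize-injective φ φ-inj (φ a))
  (≤-trans (≤-reflexive (sym (𝟙-yes (φ a ≟ φ a) refl))) (≤-∑ k′ (λ j′ → 𝟙 (φ j′ ≟ φ a)) a))

∑ˢ : ∀ n → (Subset n → ℕ) → ℕ
∑ˢ zero    f = f []
∑ˢ (suc n) f = ∑ˢ n (f ∘ (true ∷_)) + ∑ˢ n (f ∘ (false ∷_))

∑ˢ-cong : ∀ n {f g : Subset n → ℕ} → (∀ e → f e ≡ g e) → ∑ˢ n f ≡ ∑ˢ n g
∑ˢ-cong zero    f≡g = f≡g []
∑ˢ-cong (suc n) f≡g = cong₂ _+_ (∑ˢ-cong n (f≡g ∘ (true ∷_))) (∑ˢ-cong n (f≡g ∘ (false ∷_)))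

∑ˢ-zero : ∀ n {f : Subset n → ℕ} → (∀ e → f e ≡ 0) → ∑ˢ n f ≡ 0
∑ˢ-zero zero    f≡0 = f≡0 []
∑ˢ-zero (suc n) f≡0 = cong₂ _+_ (∑ˢ-zero n (f≡0 ∘ (true ∷_))) (∑ˢ-zero n (f≡0 ∘ (false ∷_)))

*-distribˡ-∑ˢ : ∀ n a (f : Subset n → ℕ) → a * ∑ˢ n f ≡ ∑ˢ n (λ e → a * f e)
*-distribˡ-∑ˢ zero    a f = refl
*-distribˡ-∑ˢ (suc n) a f = trans (*-distribˡ-+ a _ _)
  (cong₂ _+_ (*-distribˡ-∑ˢ n a (f ∘ (true ∷_))) (*-distribˡ-∑ˢ n a (f ∘ (false ∷_))))

∑ˢ-mono-≤ : ∀ n {f g : Subset n → ℕ} → (∀ e → f e ≤ g e) → ∑ˢ n f ≤ ∑ˢ n g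
∑ˢ-mono-≤ zero    f≤g = f≤g []
∑ˢ-mono-≤ (suc n) f≤g = +-mono-≤ (∑ˢ-mono-≤ n (f≤g ∘ (true ∷_))) (∑ˢ-mono-≤ n (f≤g ∘ (false ∷_)))

≤-∑ˢ : ∀ n (f : Subset n → ℕ) e → f e ≤ ∑ˢ n f
≤-∑ˢ zero    f []          = ≤-refl
≤-∑ˢ (suc n) f (true ∷ e)  = ≤-trans (≤-∑ˢ n (f ∘ (true ∷_)) e) (m≤m+n _ _)
≤-∑ˢ (suc n) f (false ∷ e) = ≤-trans (≤-∑ˢ n (f ∘ (false ∷_)) e) (m≤n+m _ _)

∑ˢ-comm-∑ : ∀ n k (f : Subset n → Fin k → ℕ) →
            ∑ˢ n (λ e → ∑[ i < k ] f e i) ≡ ∑[ i < k ] ∑ˢ n (λ e → f e i)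
∑ˢ-comm-∑ zero    k f = refl
∑ˢ-comm-∑ (suc n) k f = trans (cong₂ _+_ (∑ˢ-comm-∑ n k _) (∑ˢ-comm-∑ n k _))
  (sym (∑-distrib-+ (λ i → ∑ˢ n (λ e → f (true ∷ e) i)) (λ i → ∑ˢ n (λ e → f (false ∷ e) i))))

module _ {A : Set} {P : A → Set} (P? : Decidable P) where

  length-filter≡sum-𝟙 : ∀ xs → length (filter P? xs) ≡ List.sum (map (𝟙 ∘ P?) xs)
  length-filter≡sum-𝟙 []       = refl
  length-filter≡sum-𝟙 (x ∷ xs) with does (P? x)
  ... | true  = cong suc (length-filter≡sum-𝟙 xs)
  ... | false = length-filter≡sum-𝟙 xs

  sum-map-filter : ∀ (g : A → ℕ) xs → List.sum (map g (filter P? xs)) ≡ List.sum (map (λ x → 𝟙 (P? x) * g x) xs)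
  sum-map-filter g []       = refl
  sum-map-filter g (x ∷ xs) with does (P? x)
  ... | true  = cong₂ _+_ (sym (+-identityʳ (g x))) (sum-map-filter g xs)
  ... | false = sum-map-filter g xs

sum-map-cartesianProduct : ∀ {A B : Set} (g : A × B → ℕ) xs ys →
  List.sum (map g (cartesianProduct xs ys)) ≡ List.sum (map (λ x → List.sum (map (λ y → g (x , y)) ys)) xs)
sum-map-cartesianProduct g []       ys = refl
sum-map-cartesianProduct g (x ∷ xs) ys = begin
  List.sum (map g (map (x ,_) ys ++ cartesianProduct xs ys))
    ≡⟨ cong List.sum (map-++ g (map (x ,_) ys) _) ⟩
  List.sum (map g (map (x ,_) ys) ++ map g (cartesianProduct xs ys))
    ≡⟨ sum-++ (map g (map (x ,_) ys)) _ ⟩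
  List.sum (map g (map (x ,_) ys)) + List.sum (map g (cartesianProduct xs ys))
    ≡⟨ cong₂ _+_ (cong List.sum (sym (map-∘ ys))) (sum-map-cartesianProduct g xs ys) ⟩
  List.sum (map (λ y → g (x , y)) ys) + List.sum (map (λ x → List.sum (map (λ y → g (x , y)) ys)) xs) ∎
  where open ≡-Reasoning

sum-tabulate : ∀ k (f : Fin k → ℕ) → List.sum (tabulate f) ≡ ∑[ i < k ] f i
sum-tabulate zero    f = refl
sum-tabulate (suc k) f = cong (f fzero +_) (sum-tabulate k (f ∘ fsuc))

sum-map-allFin : ∀ k (g : Fin k → ℕ) → List.sum (map g (allFin k)) ≡ ∑[ i < k ] g i
sum-map-allFin k g = trans (cong List.sum (map-tabulate id g)) (sum-tabulate k g)

sum-map-subsets : ∀ n (g : Subset n → ℕ) → List.sum (map g (subsets n)) ≡ ∑ˢ n g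
sum-map-subsets zero    g = +-identityʳ (g [])
sum-map-subsets (suc n) g = begin
  List.sum (map g (map (true ∷_) (subsets n) ++ map (false ∷_) (subsets n)))
    ≡⟨ cong List.sum (map-++ g (map (true ∷_) (subsets n)) _) ⟩
  List.sum (map g (map (true ∷_) (subsets n)) ++ map g (map (false ∷_) (subsets n)))
    ≡⟨ sum-++ (map g (map (true ∷_) (subsets n))) _ ⟩
  List.sum (map g (map (true ∷_) (subsets n))) + List.sum (map g (map (false ∷_) (subsets n)))
    ≡⟨ cong₂ _+_ (cong List.sum (sym (map-∘ (subsets n)))) (cong List.sum (sym (map-∘ (subsets n)))) ⟩
  List.sum (map (g ∘ (true ∷_)) (subsets n)) + List.sum (map (g ∘ (false ∷_)) (subsets n))
    ≡⟨ cong₂ _+_ (sum-map-subsets n (g ∘ (true ∷_))) (sum-map-subsets n (g ∘ (false ∷_))) ⟩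
  ∑ˢ (suc n) g ∎
  where open ≡-Reasoning

x∈p⇒0<∣p∣ : ∀ {n} {x : Fin n} {p : Subset n} → x ∈ p → 0 < ∣ p ∣
x∈p⇒0<∣p∣ here                    = s≤s z≤n
x∈p⇒0<∣p∣ (there {y = true} x∈p)  = s≤s z≤n
x∈p⇒0<∣p∣ (there {y = false} x∈p) = x∈p⇒0<∣p∣ x∈p

∑ˢ-𝟙-size : ∀ n k → ∑ˢ n (λ e → 𝟙 (∣ e ∣ ℕ.≟ k)) ≡ n C k
∑ˢ-𝟙-size zero    zero    = refl
∑ˢ-𝟙-size zero    (suc k) = refl
∑ˢ-𝟙-size (suc n) zero    =
  trans (cong (_+ ∑ˢ n (λ e → 𝟙 (∣ e ∣ ℕ.≟ 0))) (∑ˢ-zero n (λ _ → refl))) (∑ˢ-𝟙-size n zero)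
∑ˢ-𝟙-size (suc n) (suc k) =
  trans (cong₂ _+_ (∑ˢ-𝟙-size n k) (∑ˢ-𝟙-size n (suc k))) (nCk+nC[k+1]≡[n+1]C[k+1] n k)

∑ˢ-𝟙-∈-size : ∀ n k (v : Fin (suc n)) →
               ∑ˢ (suc n) (λ e → 𝟙 (v ∈? e) * 𝟙 (∣ e ∣ ℕ.≟ suc k)) ≡ n C k
∑ˢ-𝟙-∈-size n k fzero = trans (cong₂ _+_ (∑ˢ-cong n (λ e → +-identityʳ _)) (∑ˢ-zero n (λ _ → refl)))
                                (trans (+-identityʳ _) (∑ˢ-𝟙-size n k))
∑ˢ-𝟙-∈-size (suc n) zero (fsuc v) = cong₂ _+_ (∑ˢ-zero (suc n) 𝟙-∈-size-0) (∑ˢ-𝟙-∈-size n zero v)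
  where
  𝟙-∈-size-0 : ∀ e → 𝟙 (v ∈? e) * 𝟙 (∣ e ∣ ℕ.≟ 0) ≡ 0
  𝟙-∈-size-0 e with v ∈? e
  ... | yes v∈e = trans (*-identityˡ _) (𝟙-no (∣ e ∣ ℕ.≟ 0) (>⇒≢ (x∈p⇒0<∣p∣ v∈e)))
  ... | no _    = refl
∑ˢ-𝟙-∈-size (suc n) (suc k) (fsuc v) =
  trans (cong₂ _+_ (∑ˢ-𝟙-∈-size n k v) (∑ˢ-𝟙-∈-size n (suc k) v)) (nCk+nC[k+1]≡[n+1]C[k+1] n k)

∑-𝟙-∈ : ∀ n (e : Subset n) → ∑[ v < n ] 𝟙 (v ∈? e) ≡ ∣ e ∣
∑-𝟙-∈ zero    []          = refl
∑-𝟙-∈ (suc n) (true ∷ e)  = cong suc (∑-𝟙-∈ n e)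
∑-𝟙-∈ (suc n) (false ∷ e) = ∑-𝟙-∈ n e

module _ {n lam k : ℕ} (h : ℕ) (c : Colouring n lam k) where

  mult : Fin k → Subset n → ℕ
  mult j e = 𝟙 (∣ e ∣ ℕ.≟ h) * ∑[ i < lam ] 𝟙 (c e i ≟ j)

  classSize : Fin k → ℕ
  classSize j = ∑ˢ n (mult j)

  deg≡∑ˢ : ∀ j v → deg h lam c j v ≡ ∑ˢ n (λ e → 𝟙 (v ∈? e) * mult j e)
  deg≡∑ˢ j v = begin
    length (filter P? (cartesianProduct (filter h? (subsets n)) (allFin lam)))
      ≡⟨ length-filter≡sum-𝟙 P? (cartesianProduct (filter h? (subsets n)) (allFin lam)) ⟩
    List.sum (map (𝟙 ∘ P?) (cartesianProduct (filter h? (subsets n)) (allFin lam)))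
      ≡⟨ sum-map-cartesianProduct (𝟙 ∘ P?) (filter h? (subsets n)) (allFin lam) ⟩
    List.sum (map copies (filter h? (subsets n)))
      ≡⟨ sum-map-filter h? copies (subsets n) ⟩
    List.sum (map (λ e → 𝟙 (h? e) * copies e) (subsets n))
      ≡⟨ sum-map-subsets n _ ⟩
    ∑ˢ n (λ e → 𝟙 (h? e) * copies e)
      ≡⟨ ∑ˢ-cong n copies≡ ⟩
    ∑ˢ n (λ e → 𝟙 (v ∈? e) * mult j e) ∎
    where
    open ≡-Reasoning
    h? : Decidable (λ (e : Subset n) → ∣ e ∣ ≡ h)
    h? e = ∣ e ∣ ℕ.≟ h
    P? : Decidable (λ (ei : Subset n × Fin lam) → _)
    P? (e , i) = (v ∈? e) ×-dec (c e i ≟ j)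
    copies : Subset n → ℕ
    copies e = List.sum (map (λ i → 𝟙 (P? (e , i))) (allFin lam))
    copies≡ : ∀ e → 𝟙 (h? e) * copies e ≡ 𝟙 (v ∈? e) * mult j e
    copies≡ e = begin
      𝟙 (h? e) * copies e
        ≡⟨ cong (𝟙 (h? e) *_) (trans (sum-map-allFin lam _) (sum-cong-≗ (λ i → 𝟙-×-dec (v ∈? e) (c e i ≟ j)))) ⟩
      𝟙 (h? e) * ∑[ i < lam ] (𝟙 (v ∈? e) * 𝟙 (c e i ≟ j))
        ≡⟨ cong (𝟙 (h? e) *_) (sym (*-distribˡ-sum (𝟙 (v ∈? e)) (λ i → 𝟙 (c e i ≟ j)))) ⟩
      𝟙 (h? e) * (𝟙 (v ∈? e) * ∑[ i < lam ] 𝟙 (c e i ≟ j))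
        ≡⟨ x∙yz≈y∙xz (𝟙 (h? e)) (𝟙 (v ∈? e)) _ ⟩
      𝟙 (v ∈? e) * mult j e ∎

  ∑-mult : ∀ e → ∑[ j < k ] mult j e ≡ 𝟙 (∣ e ∣ ℕ.≟ h) * lam
  ∑-mult e = begin
    ∑[ j < k ] (𝟙 h? * ∑[ i < lam ] 𝟙 (c e i ≟ j))
      ≡⟨ *-distribˡ-sum (𝟙 h?) (λ j → ∑[ i < lam ] 𝟙 (c e i ≟ j)) ⟨
    𝟙 h? * ∑[ j < k ] ∑[ i < lam ] 𝟙 (c e i ≟ j)
      ≡⟨ cong (𝟙 h? *_) (∑-comm (λ j i → 𝟙 (c e i ≟ j))) ⟩
    𝟙 h? * ∑[ i < lam ] ∑[ j < k ] 𝟙 (c e i ≟ j)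
      ≡⟨ cong (𝟙 h? *_) (sum-cong-≗ (λ i → ∑-𝟙-≟≡1 k (c e i))) ⟩
    𝟙 h? * ∑[ i < lam ] 1
      ≡⟨ cong (𝟙 h? *_) (trans (∑-const lam 1) (*-identityʳ lam)) ⟩
    𝟙 h? * lam ∎
    where
    open ≡-Reasoning
    h? = ∣ e ∣ ℕ.≟ h

  ∑-deg : ∀ v → ∑[ j < k ] deg h lam c j v ≡ lam * ∑ˢ n (λ e → 𝟙 (v ∈? e) * 𝟙 (∣ e ∣ ℕ.≟ h))
  ∑-deg v = begin
    ∑[ j < k ] deg h lam c j v                        ≡⟨ sum-cong-≗ (λ j → deg≡∑ˢ j v) ⟩
    ∑[ j < k ] ∑ˢ n (λ e → 𝟙 (v ∈? e) * mult j e)     ≡⟨ ∑ˢ-comm-∑ n k (λ e j → 𝟙 (v ∈? e) * mult j e) ⟨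
    ∑ˢ n (λ e → ∑[ j < k ] (𝟙 (v ∈? e) * mult j e))   ≡⟨ ∑ˢ-cong n all-classes ⟩
    ∑ˢ n (λ e → lam * (𝟙 (v ∈? e) * 𝟙 (∣ e ∣ ℕ.≟ h))) ≡⟨ *-distribˡ-∑ˢ n lam _ ⟨
    lam * ∑ˢ n (λ e → 𝟙 (v ∈? e) * 𝟙 (∣ e ∣ ℕ.≟ h))   ∎
    where
    open ≡-Reasoning
    all-classes : ∀ e → ∑[ j < k ] (𝟙 (v ∈? e) * mult j e) ≡ lam * (𝟙 (v ∈? e) * 𝟙 (∣ e ∣ ℕ.≟ h))
    all-classes e = begin
      ∑[ j < k ] (𝟙 (v ∈? e) * mult j e)   ≡⟨ *-distribˡ-sum (𝟙 (v ∈? e)) (λ j → mult j e) ⟨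
      𝟙 (v ∈? e) * ∑[ j < k ] mult j e     ≡⟨ cong (𝟙 (v ∈? e) *_) (∑-mult e) ⟩
      𝟙 (v ∈? e) * (𝟙 (∣ e ∣ ℕ.≟ h) * lam) ≡⟨ *-assoc (𝟙 (v ∈? e)) (𝟙 (∣ e ∣ ℕ.≟ h)) lam ⟨
      𝟙 (v ∈? e) * 𝟙 (∣ e ∣ ℕ.≟ h) * lam   ≡⟨ *-comm _ lam ⟩
      lam * (𝟙 (v ∈? e) * 𝟙 (∣ e ∣ ℕ.≟ h)) ∎

  0<mult : ∀ {j e} i → ∣ e ∣ ≡ h → c e i ≡ j → 0 < mult j e
  0<mult {j} {e} i ∣e∣≡h cei≡j = begin-strict
    0                              <⟨ s≤s z≤n ⟩
    1                              ≡⟨ 𝟙-yes (c e i ≟ j) cei≡j ⟨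
    𝟙 (c e i ≟ j)                  ≤⟨ ≤-∑ lam (λ i → 𝟙 (c e i ≟ j)) i ⟩
    ∑[ i < lam ] 𝟙 (c e i ≟ j)     ≡⟨ *-identityˡ _ ⟨
    1 * ∑[ i < lam ] 𝟙 (c e i ≟ j) ≡⟨ cong (_* _) (𝟙-yes (∣ e ∣ ℕ.≟ h) ∣e∣≡h) ⟨
    mult j e                       ∎
    where open ≤-Reasoning

  ∣∣*mult : ∀ j e → ∣ e ∣ * mult j e ≡ h * mult j e
  ∣∣*mult j e = *-𝟙*-cong (∣ e ∣ ℕ.≟ h) _ id

  handshake : ∀ j → ∑[ v < n ] deg h lam c j v ≡ h * classSize j
  handshake j = begin
    ∑[ v < n ] deg h lam c j v
      ≡⟨ sum-cong-≗ (deg≡∑ˢ j) ⟩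
    ∑[ v < n ] ∑ˢ n (λ e → 𝟙 (v ∈? e) * mult j e)
      ≡⟨ ∑ˢ-comm-∑ n n (λ e v → 𝟙 (v ∈? e) * mult j e) ⟨
    ∑ˢ n (λ e → ∑[ v < n ] (𝟙 (v ∈? e) * mult j e))
      ≡⟨ ∑ˢ-cong n (λ e → sym (*-distribʳ-sum (mult j e) (λ v → 𝟙 (v ∈? e)))) ⟩
    ∑ˢ n (λ e → ∑[ v < n ] 𝟙 (v ∈? e) * mult j e)
      ≡⟨ ∑ˢ-cong n (λ e → cong (_* mult j e) (∑-𝟙-∈ n e)) ⟩
    ∑ˢ n (λ e → ∣ e ∣ * mult j e)
      ≡⟨ ∑ˢ-cong n (∣∣*mult j) ⟩
    ∑ˢ n (λ e → h * mult j e)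
      ≡⟨ *-distribˡ-∑ˢ n h (mult j) ⟨
    h * classSize j ∎
    where open ≡-Reasoning

factorization-classSize : ∀ {n lam k r} h (c : Colouring n lam k) → IsFactorization n h lam r k c →
                          ∀ j → n * r ≡ h * classSize h c j
factorization-classSize {n} {r = r} h c regular j =
  trans (sym (∑-const n r)) (trans (sum-cong-≗ (sym ∘ regular j)) (handshake h c j))

factorization-classes : ∀ {n lam k r} h (c : Colouring (suc n) lam k) → IsFactorization (suc n) (suc h) lam r k c →
                        k * r ≡ lam * (n C h)
factorization-classes {n} {lam} {k} {r} h c regular = begin
  k * r                                    ≡⟨ ∑-const k r ⟨
  ∑[ j < k ] r                             ≡⟨ sum-cong-≗ (λ j → regular j fzero) ⟨
  ∑[ j < k ] deg (suc h) lam c j fzero     ≡⟨ ∑-deg (suc h) c fzero ⟩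
  lam * ∑ˢ (suc n) (λ e → 𝟙 (fzero ∈? e) * 𝟙 (∣ e ∣ ℕ.≟ suc h))
                                           ≡⟨ cong (lam *_) (∑ˢ-𝟙-∈-size n h fzero) ⟩
  lam * (n C h)                            ∎
  where open ≡-Reasoning

factorization⇒admissible : ∀ {n lam k r} h (c : Colouring (suc n) lam k) → IsFactorization (suc n) (suc h) lam r k c →
                           Fin k → Admissible (suc h) (suc n) r lam
factorization⇒admissible {n} {k = k} {r} h c regular j =
  divides (classSize (suc h) c j) (trans (*-comm r (suc n)) (trans (factorization-classSize (suc h) c regular j) (*-comm (suc h) _))) ,
  divides k (sym (factorization-classes h c regular))

outer : ∀ {m n} → m ≤ n → Subset n → ℕ
outer z≤n     e       = ∣ e ∣
outer (s≤s p) (_ ∷ e) = outer p e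

∑ˢ-split-⊥ : ∀ n (f : Subset n → ℕ) → ∑ˢ n f ≡ f (replicate n false) + ∑ˢ n (λ e → (1 ⊓ ∣ e ∣) * f e)
∑ˢ-split-⊥ zero    f = sym (+-identityʳ (f []))
∑ˢ-split-⊥ (suc n) f = begin
  ∑ˢ n (f ∘ (true ∷_)) + ∑ˢ n (f ∘ (false ∷_))
    ≡⟨ cong₂ _+_ (∑ˢ-cong n (λ e → sym (*-identityˡ _))) (∑ˢ-split-⊥ n (f ∘ (false ∷_))) ⟩
  ∑ˢ n (λ e → 1 * f (true ∷ e)) + (f (false ∷ replicate n false) + ∑ˢ n (λ e → (1 ⊓ ∣ e ∣) * f (false ∷ e)))
    ≡⟨ +-left-comm (∑ˢ n (λ e → 1 * f (true ∷ e))) (f (false ∷ replicate n false)) _ ⟩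
  f (replicate (suc n) false) + ∑ˢ (suc n) (λ e → (1 ⊓ ∣ e ∣) * f e) ∎
  where open ≡-Reasoning

∑ˢ-split : ∀ {m n} (p : m ≤ n) (f : Subset n → ℕ) →
           ∑ˢ n f ≡ ∑ˢ m (f ∘ liftS p) + ∑ˢ n (λ e → (1 ⊓ outer p e) * f e)
∑ˢ-split {n = n} z≤n f = ∑ˢ-split-⊥ n f
∑ˢ-split {suc m} {suc n} (s≤s p) f =
  trans (cong₂ _+_ (∑ˢ-split p (f ∘ (true ∷_))) (∑ˢ-split p (f ∘ (false ∷_))))
        (+-interchange (∑ˢ m (f ∘ (true ∷_) ∘ liftS p)) (∑ˢ n (λ e → (1 ⊓ outer p e) * f (true ∷ e))) _ _)

∣liftS∣ : ∀ {m n} (p : m ≤ n) e → ∣ liftS p e ∣ ≡ ∣ e ∣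
∣liftS∣ {n = n} z≤n []  = ∣⊥∣≡0 n
∣liftS∣ (s≤s p) (true ∷ e)  = cong suc (∣liftS∣ p e)
∣liftS∣ (s≤s p) (false ∷ e) = ∣liftS∣ p e

𝟙-∈-liftS : ∀ {m n} (p : m ≤ n) v e → 𝟙 (inject≤ v p ∈? liftS p e) ≡ 𝟙 (v ∈? e)
𝟙-∈-liftS (s≤s p) fzero    (true ∷ e)  = refl
𝟙-∈-liftS (s≤s p) fzero    (false ∷ e) = refl
𝟙-∈-liftS (s≤s p) (fsuc v) (_ ∷ e)     = 𝟙-∈-liftS p v e

inner+outer : ∀ {m n} (p : m ≤ n) e → ∑[ v < m ] 𝟙 (inject≤ v p ∈? e) + outer p e ≡ ∣ e ∣
inner+outer z≤n     e           = refl
inner+outer (s≤s p) (true ∷ e)  = cong suc (inner+outer p e)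
inner+outer (s≤s p) (false ∷ e) = inner+outer p e

outer≡0⇒inner : ∀ {m n} (p : m ≤ n) e {w} → outer p e ≡ 0 → w ∈ e → Σ (Fin m) λ v → inject≤ v p ≡ w
outer≡0⇒inner z≤n     e        outer≡0 w∈e = contradiction outer≡0 (>⇒≢ (x∈p⇒0<∣p∣ w∈e))
outer≡0⇒inner (s≤s p) (_ ∷ e) {fzero}  outer≡0 w∈e         = fzero , refl
outer≡0⇒inner (s≤s p) (_ ∷ e) {fsuc w} outer≡0 (there w∈e) =
  let v , v↦w = outer≡0⇒inner p e outer≡0 w∈e in fsuc v , cong fsuc v↦w

-- In class j: X counts crossing incidences at inner vertices, Y crossing edges, I inner edges.
crossing-arithmetic : ∀ h m n r s N X Y I →
  m * s ≡ m * (r * N) + X → X ≤ (h ∸ 1) * Y → h * I ≡ N * (m * r) → n * s ≡ h * (I + Y) →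
  h * (m * s) ≤ N * (m * r) + (h ∸ 1) * (n * s)
crossing-arithmetic zero    m n r s N X Y I _ _ _ _ = z≤n
crossing-arithmetic (suc h) m n r s N X Y I ms≡ X≤hY hI≡ ns≡ = begin
  suc h * (m * s)                               ≡⟨ cong (suc h *_) ms≡ ⟩
  suc h * (m * (r * N) + X)                     ≤⟨ *-monoʳ-≤ (suc h) (+-monoʳ-≤ (m * (r * N)) X≤hY) ⟩
  suc h * (m * (r * N) + h * Y)                 ≡⟨ regroup h m r N Y ⟩
  N * (m * r) + h * (N * (m * r) + suc h * Y)   ≡⟨ cong (λ t → N * (m * r) + h * t) ns≡′ ⟨
  N * (m * r) + h * (n * s)                     ∎
  where
  open ≤-Reasoning
  regroup : ∀ h m r N Y → suc h * (m * (r * N) + h * Y) ≡ N * (m * r) + h * (N * (m * r) + suc h * Y)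
  regroup = solve-∀
  ns≡′ : n * s ≡ N * (m * r) + suc h * Y
  ns≡′ = trans ns≡ (trans (*-distribˡ-+ (suc h) I Y) (cong (_+ suc h * Y) hI≡))

module Embedding {m n h lam r s k′ k : ℕ} (m≤n : m ≤ n)
  (d : Colouring m lam k′) (d-regular : IsFactorization m h lam r k′ d)
  (c : Colouring n lam k) (c-regular : IsFactorization n h lam s k c)
  (φ : Fin k′ → Fin k) (d⊆c : (e : Subset m) (i : Fin lam) → ∣ e ∣ ≡ h → c (liftS m≤n e) i ≡ φ (d e i)) where

  ↑ : Fin m → Fin n
  ↑ v = inject≤ v m≤n

  -- 1 if e contains an outer vertex, 0 otherwise
  crossing : Subset n → ℕ
  crossing e = 1 ⊓ outer m≤n e

  crossingDeg : Fin k → Fin m → ℕ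
  crossingDeg j v = ∑ˢ n (λ e → crossing e * (𝟙 (↑ v ∈? e) * mult h c j e))

  crossingSize : Fin k → ℕ
  crossingSize j = ∑ˢ n (λ e → crossing e * mult h c j e)

  innerSize : Fin k → ℕ
  innerSize j = ∑ˢ m (mult h c j ∘ liftS m≤n)

  mult-liftS : ∀ j e → mult h c j (liftS m≤n e) ≡ ∑[ j′ < k′ ] (𝟙 (φ j′ ≟ j) * mult h d j′ e)
  mult-liftS j e = begin
    𝟙 (∣ liftS m≤n e ∣ ℕ.≟ h) * ∑[ i < lam ] 𝟙 (c (liftS m≤n e) i ≟ j)
      ≡⟨ cong (λ x → 𝟙 (x ℕ.≟ h) * ∑[ i < lam ] 𝟙 (c (liftS m≤n e) i ≟ j)) (∣liftS∣ m≤n e) ⟩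
    𝟙 h? * ∑[ i < lam ] 𝟙 (c (liftS m≤n e) i ≟ j)
      ≡⟨ 𝟙*-cong h? (λ ∣e∣≡h → sum-cong-≗ (λ i → cong (λ a → 𝟙 (a ≟ j)) (d⊆c e i ∣e∣≡h))) ⟩
    𝟙 h? * ∑[ i < lam ] 𝟙 (φ (d e i) ≟ j)
      ≡⟨ cong (𝟙 h? *_) (sum-cong-≗ (λ i → sym (∑-𝟙-≟ k′ (d e i) (λ j′ → 𝟙 (φ j′ ≟ j))))) ⟩
    𝟙 h? * ∑[ i < lam ] ∑[ j′ < k′ ] (𝟙 (d e i ≟ j′) * 𝟙 (φ j′ ≟ j))
      ≡⟨ cong (𝟙 h? *_) (∑-comm (λ i j′ → 𝟙 (d e i ≟ j′) * 𝟙 (φ j′ ≟ j))) ⟩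
    𝟙 h? * ∑[ j′ < k′ ] ∑[ i < lam ] (𝟙 (d e i ≟ j′) * 𝟙 (φ j′ ≟ j))
      ≡⟨ cong (𝟙 h? *_) (sum-cong-≗ λ j′ → sym (*-distribʳ-sum (𝟙 (φ j′ ≟ j)) (λ i → 𝟙 (d e i ≟ j′)))) ⟩
    𝟙 h? * ∑[ j′ < k′ ] (∑[ i < lam ] 𝟙 (d e i ≟ j′) * 𝟙 (φ j′ ≟ j))
      ≡⟨ *-distribˡ-sum (𝟙 h?) (λ j′ → ∑[ i < lam ] 𝟙 (d e i ≟ j′) * 𝟙 (φ j′ ≟ j)) ⟩
    ∑[ j′ < k′ ] (𝟙 h? * (∑[ i < lam ] 𝟙 (d e i ≟ j′) * 𝟙 (φ j′ ≟ j)))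
      ≡⟨ sum-cong-≗ (λ j′ → trans (sym (*-assoc (𝟙 h?) _ _)) (*-comm _ (𝟙 (φ j′ ≟ j)))) ⟩
    ∑[ j′ < k′ ] (𝟙 (φ j′ ≟ j) * mult h d j′ e) ∎
    where
    open ≡-Reasoning
    h? = ∣ e ∣ ℕ.≟ h

  ∑ˢ-mult-liftS : ∀ (ω : Subset m → ℕ) j →
    ∑ˢ m (λ e → ω e * mult h c j (liftS m≤n e)) ≡
    ∑[ j′ < k′ ] (𝟙 (φ j′ ≟ j) * ∑ˢ m (λ e → ω e * mult h d j′ e))
  ∑ˢ-mult-liftS ω j = begin
    ∑ˢ m (λ e → ω e * mult h c j (liftS m≤n e))
      ≡⟨ ∑ˢ-cong m (λ e → cong (ω e *_) (mult-liftS j e)) ⟩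
    ∑ˢ m (λ e → ω e * ∑[ j′ < k′ ] (𝟙 (φ j′ ≟ j) * mult h d j′ e))
      ≡⟨ ∑ˢ-cong m (λ e → trans (*-distribˡ-sum (ω e) (λ j′ → 𝟙 (φ j′ ≟ j) * mult h d j′ e))
                                (sum-cong-≗ (λ j′ → x∙yz≈y∙xz (ω e) (𝟙 (φ j′ ≟ j)) (mult h d j′ e)))) ⟩
    ∑ˢ m (λ e → ∑[ j′ < k′ ] (𝟙 (φ j′ ≟ j) * (ω e * mult h d j′ e)))
      ≡⟨ ∑ˢ-comm-∑ m k′ (λ e j′ → 𝟙 (φ j′ ≟ j) * (ω e * mult h d j′ e)) ⟩
    ∑[ j′ < k′ ] ∑ˢ m (λ e → 𝟙 (φ j′ ≟ j) * (ω e * mult h d j′ e))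
      ≡⟨ sum-cong-≗ (λ j′ → sym (*-distribˡ-∑ˢ m (𝟙 (φ j′ ≟ j)) _)) ⟩
    ∑[ j′ < k′ ] (𝟙 (φ j′ ≟ j) * ∑ˢ m (λ e → ω e * mult h d j′ e)) ∎
    where open ≡-Reasoning

  ∑-𝟙-φ≟-const : ∀ j a → ∑[ j′ < k′ ] (𝟙 (φ j′ ≟ j) * a) ≡ a * fibreSize φ j
  ∑-𝟙-φ≟-const j a = trans (sym (*-distribʳ-sum a (λ j′ → 𝟙 (φ j′ ≟ j)))) (*-comm _ a)

  deg-split : ∀ j v → s ≡ r * fibreSize φ j + crossingDeg j v
  deg-split j v = begin
    s
      ≡⟨ c-regular j (↑ v) ⟨
    deg h lam c j (↑ v)
      ≡⟨ deg≡∑ˢ h c j (↑ v) ⟩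
    ∑ˢ n (λ e → 𝟙 (↑ v ∈? e) * mult h c j e)
      ≡⟨ ∑ˢ-split m≤n (λ e → 𝟙 (↑ v ∈? e) * mult h c j e) ⟩
    ∑ˢ m (λ e → 𝟙 (↑ v ∈? liftS m≤n e) * mult h c j (liftS m≤n e)) + crossingDeg j v
      ≡⟨ cong (_+ crossingDeg j v) innerDeg ⟩
    r * fibreSize φ j + crossingDeg j v ∎
    where
    open ≡-Reasoning
    innerDeg : ∑ˢ m (λ e → 𝟙 (↑ v ∈? liftS m≤n e) * mult h c j (liftS m≤n e)) ≡ r * fibreSize φ j
    innerDeg = begin
      ∑ˢ m (λ e → 𝟙 (↑ v ∈? liftS m≤n e) * mult h c j (liftS m≤n e))
        ≡⟨ ∑ˢ-cong m (λ e → cong (_* mult h c j (liftS m≤n e)) (𝟙-∈-liftS m≤n v e)) ⟩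
      ∑ˢ m (λ e → 𝟙 (v ∈? e) * mult h c j (liftS m≤n e))
        ≡⟨ ∑ˢ-mult-liftS (λ e → 𝟙 (v ∈? e)) j ⟩
      ∑[ j′ < k′ ] (𝟙 (φ j′ ≟ j) * ∑ˢ m (λ e → 𝟙 (v ∈? e) * mult h d j′ e))
        ≡⟨ sum-cong-≗ (λ j′ → cong (𝟙 (φ j′ ≟ j) *_) (trans (sym (deg≡∑ˢ h d j′ v)) (d-regular j′ v))) ⟩
      ∑[ j′ < k′ ] (𝟙 (φ j′ ≟ j) * r)
        ≡⟨ ∑-𝟙-φ≟-const j r ⟩
      r * fibreSize φ j ∎

  innerSize-handshake : ∀ j → h * innerSize j ≡ fibreSize φ j * (m * r)
  innerSize-handshake j = begin
    h * ∑ˢ m (mult h c j ∘ liftS m≤n)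
      ≡⟨ cong (h *_) (∑ˢ-cong m (λ e → sym (*-identityˡ _))) ⟩
    h * ∑ˢ m (λ e → 1 * mult h c j (liftS m≤n e))
      ≡⟨ cong (h *_) (∑ˢ-mult-liftS (λ _ → 1) j) ⟩
    h * ∑[ j′ < k′ ] (𝟙 (φ j′ ≟ j) * ∑ˢ m (λ e → 1 * mult h d j′ e))
      ≡⟨ cong (h *_) (sum-cong-≗ (λ j′ → cong (𝟙 (φ j′ ≟ j) *_) (∑ˢ-cong m (λ e → *-identityˡ _)))) ⟩
    h * ∑[ j′ < k′ ] (𝟙 (φ j′ ≟ j) * classSize h d j′)
      ≡⟨ *-distribˡ-sum h (λ j′ → 𝟙 (φ j′ ≟ j) * classSize h d j′) ⟩
    ∑[ j′ < k′ ] (h * (𝟙 (φ j′ ≟ j) * classSize h d j′))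
      ≡⟨ sum-cong-≗ (λ j′ → trans (x∙yz≈y∙xz h (𝟙 (φ j′ ≟ j)) (classSize h d j′))
                                   (cong (𝟙 (φ j′ ≟ j) *_) (sym (factorization-classSize h d d-regular j′)))) ⟩
    ∑[ j′ < k′ ] (𝟙 (φ j′ ≟ j) * (m * r))
      ≡⟨ trans (∑-𝟙-φ≟-const j (m * r)) (*-comm (m * r) _) ⟩
    fibreSize φ j * (m * r) ∎
    where open ≡-Reasoning

  ∑-crossingDeg : ∀ j → ∑[ v < m ] crossingDeg j v ≤ (h ∸ 1) * crossingSize j
  ∑-crossingDeg j = begin
    ∑[ v < m ] crossingDeg j v
      ≡⟨ ∑ˢ-comm-∑ n m (λ e v → crossing e * (𝟙 (↑ v ∈? e) * mult h c j e)) ⟨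
    ∑ˢ n (λ e → ∑[ v < m ] (crossing e * (𝟙 (↑ v ∈? e) * mult h c j e)))
      ≡⟨ ∑ˢ-cong n (λ e → trans (sym (*-distribˡ-sum (crossing e) (λ v → 𝟙 (↑ v ∈? e) * mult h c j e)))
                                (cong (crossing e *_) (sym (*-distribʳ-sum (mult h c j e) (λ v → 𝟙 (↑ v ∈? e)))))) ⟩
    ∑ˢ n (λ e → crossing e * (inner e * mult h c j e))
      ≤⟨ ∑ˢ-mono-≤ n (λ e → crossing-inner≤ e (outer m≤n e) (inner+outer m≤n e)) ⟩
    ∑ˢ n (λ e → (h ∸ 1) * (crossing e * mult h c j e))
      ≡⟨ *-distribˡ-∑ˢ n (h ∸ 1) _ ⟨
    (h ∸ 1) * crossingSize j ∎
    where
    open ≤-Reasoning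
    inner : Subset n → ℕ
    inner e = ∑[ v < m ] 𝟙 (↑ v ∈? e)
    crossing-inner≤ : ∀ e o → inner e + o ≡ ∣ e ∣ →
                      (1 ⊓ o) * (inner e * mult h c j e) ≤ (h ∸ 1) * ((1 ⊓ o) * mult h c j e)
    crossing-inner≤ e zero    _            = z≤n
    crossing-inner≤ e (suc o) inner+o≡∣e∣ = begin
      1 * (inner e * mult h c j e) ≡⟨ *-identityˡ _ ⟩
      inner e * mult h c j e       ≤⟨ *-𝟙*-mono-≤ (∣ e ∣ ℕ.≟ h) _ inner≤h∸1 ⟩
      (h ∸ 1) * mult h c j e       ≡⟨ cong ((h ∸ 1) *_) (*-identityˡ _) ⟨
      (h ∸ 1) * (1 * mult h c j e) ∎
      where
      inner≤h∸1 : ∣ e ∣ ≡ h → inner e ≤ h ∸ 1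
      inner≤h∸1 ∣e∣≡h = m+n≤o⇒m≤o∸n (inner e)
        (≤-trans (+-monoʳ-≤ (inner e) (s≤s z≤n)) (≤-reflexive (trans inner+o≡∣e∣ ∣e∣≡h)))

  crossing-inequality : ∀ j → h * (m * s) ≤ fibreSize φ j * (m * r) + (h ∸ 1) * (n * s)
  crossing-inequality j =
    crossing-arithmetic h m n r s (fibreSize φ j) (∑[ v < m ] crossingDeg j v) (crossingSize j) (innerSize j)
      ms≡ (∑-crossingDeg j) (innerSize-handshake j) ns≡
    where
    ms≡ : m * s ≡ m * (r * fibreSize φ j) + ∑[ v < m ] crossingDeg j v
    ms≡ = begin
      m * s
        ≡⟨ ∑-const m s ⟨
      ∑[ v < m ] s
        ≡⟨ sum-cong-≗ (deg-split j) ⟩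
      ∑[ v < m ] (r * fibreSize φ j + crossingDeg j v)
        ≡⟨ ∑-distrib-+ (λ _ → r * fibreSize φ j) (crossingDeg j) ⟩
      ∑[ v < m ] (r * fibreSize φ j) + ∑[ v < m ] crossingDeg j v
        ≡⟨ cong (_+ ∑[ v < m ] crossingDeg j v) (∑-const m _) ⟩
      m * (r * fibreSize φ j) + ∑[ v < m ] crossingDeg j v ∎
      where open ≡-Reasoning
    ns≡ : n * s ≡ h * (innerSize j + crossingSize j)
    ns≡ = trans (factorization-classSize h c c-regular j) (cong (h *_) (∑ˢ-split m≤n (mult h c j)))

  empty-class-bound : ∀ j .{{_ : NonZero s}} → fibreSize φ j ≡ 0 → h * m ≤ (h ∸ 1) * n
  empty-class-bound j N≡0 = *-cancelʳ-≤ (h * m) ((h ∸ 1) * n) s (begin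
    h * m * s                                     ≡⟨ *-assoc h m s ⟩
    h * (m * s)                                   ≤⟨ crossing-inequality j ⟩
    fibreSize φ j * (m * r) + (h ∸ 1) * (n * s)   ≡⟨ cong (λ N → N * (m * r) + (h ∸ 1) * (n * s)) N≡0 ⟩
    (h ∸ 1) * (n * s)                             ≡⟨ *-assoc (h ∸ 1) n s ⟨
    (h ∸ 1) * n * s                               ∎)
    where open ≤-Reasoning

  singleton-class-bound : ∀ j → fibreSize φ j ≡ 1 → (h * s ∸ r) * m ≤ s * (h ∸ 1) * n
  singleton-class-bound j N≡1 = begin
    (h * s ∸ r) * m      ≡⟨ *-distribʳ-∸ m (h * s) r ⟩
    h * s * m ∸ r * m    ≤⟨ m≤n+o⇒m∸n≤o (h * s * m) (r * m) hsm≤ ⟩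
    (h ∸ 1) * (n * s)    ≡⟨ rearrange (h ∸ 1) n s ⟩
    s * (h ∸ 1) * n      ∎
    where
    open ≤-Reasoning
    rearrange : ∀ a n s → a * (n * s) ≡ s * a * n
    rearrange = solve-∀
    hsm≤ : h * s * m ≤ r * m + (h ∸ 1) * (n * s)
    hsm≤ = begin
      h * s * m                                    ≡⟨ trans (*-assoc h s m) (cong (h *_) (*-comm s m)) ⟩
      h * (m * s)                                  ≤⟨ crossing-inequality j ⟩
      fibreSize φ j * (m * r) + (h ∸ 1) * (n * s)  ≡⟨ cong (λ N → N * (m * r) + (h ∸ 1) * (n * s)) N≡1 ⟩
      1 * (m * r) + (h ∸ 1) * (n * s)              ≡⟨ cong (_+ (h ∸ 1) * (n * s)) (trans (*-identityˡ (m * r)) (*-comm m r)) ⟩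
      r * m + (h ∸ 1) * (n * s)                    ∎

  Inner : Fin n → Set
  Inner w = Σ (Fin m) λ v → ↑ v ≡ w

  no-crossing⇒closed : ∀ j → (∀ v → crossingDeg j v ≡ 0) → ∀ {u w} → Linked h c j u w → Inner u → Inner w
  no-crossing⇒closed j noCrossing here u-inner = u-inner
  no-crossing⇒closed j noCrossing (step e i ∣e∣≡h cei≡j u∈e w∈e path) (v , refl) with outer m≤n e in outer≡
  ... | zero  = no-crossing⇒closed j noCrossing path (outer≡0⇒inner m≤n e outer≡ w∈e)
  ... | suc o = contradiction (noCrossing v) (>⇒≢ (≤-trans 0<term (≤-∑ˢ n _ e)))
    where
    term≡mult : crossing e * (𝟙 (↑ v ∈? e) * mult h c j e) ≡ mult h c j e
    term≡mult = trans (cong₂ _*_ (cong (1 ⊓_) outer≡) (cong (_* mult h c j e) (𝟙-yes (↑ v ∈? e) u∈e)))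
                      (trans (*-identityˡ _) (*-identityˡ _))
    0<term : 0 < crossing e * (𝟙 (↑ v ∈? e) * mult h c j e)
    0<term = subst (0 <_) (sym term≡mult) (0<mult h c i ∣e∣≡h cei≡j)

  r<s : Injective _≡_ _≡_ φ → Fin k′ → Fin m → (m<n : m < n) → AllConnected n h lam k c → r < s
  r<s φ-inj j′ v₀ m<n connected = ≰⇒> λ s≤r →
    outside-not-inner (no-crossing⇒closed j (no-crossing s≤r) (connected j (↑ v₀) (fromℕ< m<n)) (v₀ , refl))
    where
    j = φ j′
    no-crossing : s ≤ r → ∀ v → crossingDeg j v ≡ 0
    no-crossing s≤r v = n≤0⇒n≡0 (+-cancelˡ-≤ r (crossingDeg j v) 0 (begin
      r + crossingDeg j v                   ≡⟨ cong (_+ crossingDeg j v) r*N≡r ⟨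
      r * fibreSize φ j + crossingDeg j v   ≡⟨ deg-split j v ⟨
      s                                     ≤⟨ s≤r ⟩
      r                                     ≡⟨ +-identityʳ r ⟨
      r + 0                                 ∎))
      where
      open ≤-Reasoning
      r*N≡r : r * fibreSize φ j ≡ r
      r*N≡r = trans (cong (r *_) (fibreSize-image φ φ-inj j′)) (*-identityʳ r)
    outside-not-inner : Inner (fromℕ< m<n) → ⊥
    outside-not-inner (v , ↑v≡) =
      <-irrefl (trans (sym (toℕ-inject≤ v m≤n)) (trans (cong toℕ ↑v≡) (toℕ-fromℕ< m<n))) (toℕ<n v)

scaled-class-count : ∀ {lam a k r} s → k * r ≡ lam * a → lam * (s * a) ≡ k * (r * s)
scaled-class-count {lam} {a} {k} {r} s kr≡ = begin
  lam * (s * a) ≡⟨ x∙yz≈y∙xz lam s a ⟩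
  s * (lam * a) ≡⟨ cong (s *_) kr≡ ⟨
  s * (k * r)   ≡⟨ x∙yz≈y∙xz s k r ⟩
  k * (s * r)   ≡⟨ cong (k *_) (*-comm s r) ⟩
  k * (r * s)   ∎
  where open ≡-Reasoning

module _ {lam a b k′ k r s : ℕ} .{{_ : NonZero lam}} (k′r≡ : k′ * r ≡ lam * a) (ks≡ : k * s ≡ lam * b) where

  private
    rb-count : lam * (r * b) ≡ k * (r * s)
    rb-count = trans (scaled-class-count {lam} {b} {k} {s} r ks≡) (cong (k *_) (*-comm s r))

  class-ratio-≤ : k′ ≤ k → s * a ≤ r * b
  class-ratio-≤ k′≤k = *-cancelˡ-≤ lam (begin
    lam * (s * a)  ≡⟨ scaled-class-count {lam} {a} {k′} {r} s k′r≡ ⟩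
    k′ * (r * s)   ≤⟨ *-monoˡ-≤ (r * s) k′≤k ⟩
    k * (r * s)    ≡⟨ rb-count ⟨
    lam * (r * b)  ∎)
    where open ≤-Reasoning

  class-ratio-< : s * a < r * b → k′ < k
  class-ratio-< sa<rb = *-cancelʳ-< (r * s) k′ k (begin-strict
    k′ * (r * s)   ≡⟨ scaled-class-count {lam} {a} {k′} {r} s k′r≡ ⟨
    lam * (s * a)  <⟨ *-monoʳ-< lam sa<rb ⟩
    lam * (r * b)  ≡⟨ rb-count ⟩
    k * (r * s)    ∎)
    where open ≤-Reasoning

lemma8p2 : (m n h r s lam : ℕ) → 1 ≤ r → 1 ≤ s → 1 ≤ lam → 2 ≤ h → h < m → (m<n : m < n) →
    Embeds m n h lam r s (<⇒≤ m<n) →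
    (Admissible h m r lam × Admissible h n s lam)
    × (r < s × s * ((m ∸ 1) C (h ∸ 1)) ≤ r * ((n ∸ 1) C (h ∸ 1)))
    × (s * ((m ∸ 1) C (h ∸ 1)) < r * ((n ∸ 1) C (h ∸ 1)) → h * m ≤ (h ∸ 1) * n)
    × (s * ((m ∸ 1) C (h ∸ 1)) ≡ r * ((n ∸ 1) C (h ∸ 1)) → (h * s ∸ r) * m ≤ s * (h ∸ 1) * n)
lemma8p2 (suc m) (suc n) (suc h) r (suc s) (suc lam) _ _ _ (s≤s _) _ m<n
         (k′ , d , d-regular , k , c , c-regular , connected , φ , φ-inj , d⊆c) =
    (factorization⇒admissible h d d-regular j₀ , factorization⇒admissible h c c-regular (φ j₀))
  , (r<s φ-inj j₀ fzero m<n connected , class-ratio-≤ {suc lam} classes-d classes-c (injective⇒≤ φ-inj))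
  , (λ ratio< → let j , emptyFibre = k′<k⇒∃-emptyFibre φ (class-ratio-< {suc lam} classes-d classes-c ratio<)
                in empty-class-bound j emptyFibre)
  , (λ _ → singleton-class-bound (φ j₀) (fibreSize-image φ φ-inj j₀))
  where
  open Embedding (<⇒≤ m<n) d d-regular c c-regular φ d⊆c
  -- any value of d is a class of the small factorization; the argument need not be an edge
  j₀ : Fin k′
  j₀ = d (replicate (suc m) false) fzero
  classes-d : k′ * r ≡ suc lam * (m C h)
  classes-d = factorization-classes h d d-regular
  classes-c : k * suc s ≡ suc lam * (n C h)
  classes-c = factorization-classes h c c-regular
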